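{- For all integers $k\ge 0$ and $n\ge 1$, $p^{n+k}_{n,n+k;\le n+k}=p_{n-1,n+k-1;\le n+k-1}$.
   Context: Parking model: there are $m$ parking spaces in a line, numbered $1,\dots,m$. A preference set of length $n$ is a sequence $(a_1,\dots,a_n)$ of integers with $1\le a_i\le m$; cars $1,\dots,n$ arrive in order, car $i$ parks in the first unoccupied space numbered $\ge a_i$ if one exists, otherwise it fails to park. A parking function is a preference set in which all cars park. $p_{n,m;\le s}$ denotes the number of parking functions of length $n$ with $m$ spaces and all $a_i\le s$, and $p^l_{n,m;\le s}$ the number of those with $a_1=l$. The empty sequence counts as a parking function. -}

module Defs where

open import Data.Nat using (ℕ; zero; suc; _+_; _≤ᵇ_; _≡ᵇ_)
open import Data.Bool using (Bool; true; false; _∧_; not)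
open import Data.List using (List; []; _∷_; length; filter; map; concatMap; upTo)
open import Data.Bool.ListAction using (any; all)
open import Data.Maybe using (Maybe; just; nothing)
open import Relation.Nullary.Decidable using (Dec)
open import Data.Bool.Properties using (T?)
open import Function using (_∘_)

occupied : List ℕ → ℕ → Bool
occupied xs j = any (λ x → x ≡ᵇ j) xs

-- First unoccupied space numbered ≥ a and ≤ m (the search tries a, a+1, …, m).
-- `fuel` bounds the search; started with fuel m it scans all spaces a..m.
findSpace : (fuel : ℕ) → (m : ℕ) → List ℕ → (a : ℕ) → Maybe ℕ
findSpace zero m xs a = nothing
findSpace (suc f) m xs a with a ≤ᵇ m
... | false = nothing
... | true with occupied xs a
...   | true  = findSpace f m xs (suc a)
...   | false = just a

parksAll : (m : ℕ) → (occ : List ℕ) → (prefs : List ℕ) → Bool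
parksAll m occ [] = true
parksAll m occ (a ∷ as) with findSpace m m occ a
... | nothing = false
... | just j  = parksAll m (j ∷ occ) as

isPrefSet : ℕ → List ℕ → Bool
isPrefSet m = all (λ a → (1 ≤ᵇ a) ∧ (a ≤ᵇ m))

isParkingFunction : ℕ → List ℕ → Bool
isParkingFunction m as = isPrefSet m as ∧ parksAll m [] as

seqs : (n s : ℕ) → List (List ℕ)
seqs zero s = [] ∷ []
seqs (suc n) s = concatMap (λ a → map (a ∷_) (seqs n s)) (map suc (upTo s))

p≤ : (n m s : ℕ) → ℕ
p≤ n m s = length (filter (T? ∘ isParkingFunction m) (seqs n s))

headIs : ℕ → List ℕ → Bool
headIs l [] = false
headIs l (a ∷ _) = a ≡ᵇ l

pˡ≤ : (l n m s : ℕ) → ℕ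
pˡ≤ l n m s =
  length (filter (T? ∘ (λ as → headIs l as ∧ isParkingFunction m as)) (seqs n s))

-- The first car, preferring the last space m = n + k, parks there.  The remaining cars then
-- see the lot 1..m with space m already full, which behaves exactly like the lot 1..m-1:
-- a car preferring m fails, and any other car parks in the same space in both lots.  So the
-- tails are precisely the parking functions of length n-1 with m-1 spaces, and since their
-- entries are ≤ m-1 anyway, widening the alphabet from 1..m-1 to 1..m adds no sequences.
module Submission where

open import Defs
open import Data.Nat using (ℕ; suc; _+_; _∸_)
open import Relation.Binary.PropositionalEquality using (_≡_)

open import Data.Nat using (zero; _≤_; _<_; _≤?_; _≟_; _≤ᵇ_; _≡ᵇ_; z≤n; s≤s)
open import Data.Nat.Properties
  using (≤-refl; n≤1+n; ≤ᵇ⇒≤; m≤n⇒m<n∨m≡n; m≤n⇒m≤1+n; n<1+n; m≤n+m; <⇒≱; <⇒≢; ≰⇒>; +-identityʳ; +-suc)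
open import Data.Bool using (Bool; true; false; T; _∧_; _∨_)
open import Data.Bool.Properties using (T?; T-∧; ∧-zeroʳ; ∨-zeroʳ)
open import Data.List using (List; []; _∷_; _++_; length; filter; map; concatMap; upTo)
open import Data.Nat.ListAction using (sum)
open import Data.Nat.ListAction.Properties using (sum-++)
open import Data.List.Properties using (filter-++; length-++; upTo-∷ʳ; map-++; map-cong)
open import Data.List.Relation.Unary.All using (All; []; _∷_)
open import Data.Maybe using (just; nothing)
open import Data.Product using (_,_)
open import Data.Sum using (inj₁; inj₂)
open import Data.Empty using (⊥-elim)
open import Function using (_∘_; Equivalence)
open import Relation.Nullary using (yes; no)
open import Relation.Nullary.Decidable using (dec-true; dec-false)
open import Relation.Binary.PropositionalEquality using (_≢_; refl; sym; trans; cong; cong₂; subst; module ≡-Reasoning)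

open Equivalence using (to)
open ≡-Reasoning

-- does (m ≟ n) and does (m ≤? n) compute to m ≡ᵇ n and m ≤ᵇ n, so dec-true and dec-false
-- evaluate the boolean tests of the parking procedure.

private variable
  m s t : ℕ

sumOneTo : ℕ → (ℕ → ℕ) → ℕ
sumOneTo s g = sum (map g (map suc (upTo s)))

sumOneTo-cong : ∀ {g h} → (∀ a → g a ≡ h a) → sumOneTo s g ≡ sumOneTo s h
sumOneTo-cong {s} g≗h = cong sum (map-cong g≗h (map suc (upTo s)))

sumOneTo-suc : ∀ s g → sumOneTo (suc s) g ≡ sumOneTo s g + g (suc s)
sumOneTo-suc s g = begin
  sum (map g (map suc (upTo (suc s))))             ≡⟨ cong (sum ∘ map g ∘ map suc) (sym (upTo-∷ʳ s)) ⟩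
  sum (map g (map suc (upTo s ++ s ∷ [])))         ≡⟨ cong (sum ∘ map g) (map-++ suc (upTo s) _) ⟩
  sum (map g (map suc (upTo s) ++ suc s ∷ []))     ≡⟨ cong sum (map-++ g (map suc (upTo s)) _) ⟩
  sum (map g (map suc (upTo s)) ++ g (suc s) ∷ []) ≡⟨ sum-++ (map g (map suc (upTo s))) _ ⟩
  sumOneTo s g + (g (suc s) + 0)                   ≡⟨ cong (sumOneTo s g +_) (+-identityʳ _) ⟩
  sumOneTo s g + g (suc s)                         ∎

sumOneTo-vanishing : ∀ {g} → t ≤ s → (∀ a → t < a → a ≤ s → g a ≡ 0) → sumOneTo s g ≡ sumOneTo t g
sumOneTo-vanishing {s = zero} z≤n _ = refl
sumOneTo-vanishing {t} {suc s} {g} t≤1+s g≡0 with m≤n⇒m<n∨m≡n t≤1+s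
... | inj₂ refl = refl
... | inj₁ (s≤s t≤s) = begin
  sumOneTo (suc s) g           ≡⟨ sumOneTo-suc s g ⟩
  sumOneTo s g + g (suc s)     ≡⟨ cong₂ _+_ (sumOneTo-vanishing t≤s g≡0′) (g≡0 (suc s) (s≤s t≤s) ≤-refl) ⟩
  sumOneTo t g + 0             ≡⟨ +-identityʳ _ ⟩
  sumOneTo t g                 ∎
  where
  g≡0′ : ∀ a → t < a → a ≤ s → g a ≡ 0
  g≡0′ a t<a a≤s = g≡0 a t<a (m≤n⇒m≤1+n a≤s)

sumOneTo-single : ∀ {l g} → 1 ≤ l → l ≤ s → (∀ a → a ≢ l → g a ≡ 0) → sumOneTo s g ≡ g l
sumOneTo-single {s} {suc l} {g} _ l≤s g≡0 = begin
  sumOneTo s g                 ≡⟨ sumOneTo-vanishing l≤s (λ a l<a _ → g≡0 a (<⇒≢ l<a ∘ sym)) ⟩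
  sumOneTo (suc l) g           ≡⟨ sumOneTo-suc l g ⟩
  sumOneTo l g + g (suc l)     ≡⟨ cong (_+ g (suc l)) (sumOneTo-vanishing z≤n below) ⟩
  g (suc l)                    ∎
  where
  below : ∀ a → 0 < a → a ≤ l → g a ≡ 0
  below a _ a≤l = g≡0 a (<⇒≢ (s≤s a≤l))

count : (List ℕ → Bool) → List (List ℕ) → ℕ
count Q = length ∘ filter (T? ∘ Q)

count-++ : ∀ Q xs ys → count Q (xs ++ ys) ≡ count Q xs + count Q ys
count-++ Q xs ys = begin
  length (filter (T? ∘ Q) (xs ++ ys))                         ≡⟨ cong length (filter-++ (T? ∘ Q) xs ys) ⟩
  length (filter (T? ∘ Q) xs ++ filter (T? ∘ Q) ys)           ≡⟨ length-++ (filter (T? ∘ Q) xs) ⟩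
  count Q xs + count Q ys                                     ∎

count-map-∷ : ∀ Q a xss → count Q (map (a ∷_) xss) ≡ count (Q ∘ (a ∷_)) xss
count-map-∷ Q a [] = refl
count-map-∷ Q a (xs ∷ xss) with Q (a ∷ xs)
... | true  = cong suc (count-map-∷ Q a xss)
... | false = count-map-∷ Q a xss

count-concatMap : ∀ Q (f : ℕ → List (List ℕ)) as → count Q (concatMap f as) ≡ sum (map (count Q ∘ f) as)
count-concatMap Q f [] = refl
count-concatMap Q f (a ∷ as) = begin
  count Q (f a ++ concatMap f as)                ≡⟨ count-++ Q (f a) (concatMap f as) ⟩
  count Q (f a) + count Q (concatMap f as)       ≡⟨ cong (count Q (f a) +_) (count-concatMap Q f as) ⟩
  count Q (f a) + sum (map (count Q ∘ f) as)     ∎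

count-cong : ∀ {Q R} → (∀ xs → Q xs ≡ R xs) → ∀ xss → count Q xss ≡ count R xss
count-cong Q≗R [] = refl
count-cong {Q} {R} Q≗R (xs ∷ xss) with Q xs | R xs | Q≗R xs
... | true  | true  | refl = cong suc (count-cong Q≗R xss)
... | false | false | refl = count-cong Q≗R xss

count-none : ∀ {Q} → (∀ xs → Q xs ≡ false) → ∀ xss → count Q xss ≡ 0
count-none Q≡false [] = refl
count-none Q≡false (xs ∷ xss) rewrite Q≡false xs = count-none Q≡false xss

count-seqs-suc : ∀ Q n s →
  count Q (seqs (suc n) s) ≡ sumOneTo s (λ a → count (Q ∘ (a ∷_)) (seqs n s))
count-seqs-suc Q n s = begin
  count Q (concatMap (λ a → map (a ∷_) (seqs n s)) (map suc (upTo s)))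
    ≡⟨ count-concatMap Q (λ a → map (a ∷_) (seqs n s)) (map suc (upTo s)) ⟩
  sumOneTo s (λ a → count Q (map (a ∷_) (seqs n s)))
    ≡⟨ sumOneTo-cong {s} (λ a → count-map-∷ Q a (seqs n s)) ⟩
  sumOneTo s (λ a → count (Q ∘ (a ∷_)) (seqs n s))
    ∎

count-headIs-seqs : ∀ Q n {l} → 1 ≤ l → l ≤ s →
  count (λ as → headIs l as ∧ Q as) (seqs (suc n) s) ≡ count (Q ∘ (l ∷_)) (seqs n s)
count-headIs-seqs {s} Q n {l} 1≤l l≤s = begin
  count (λ as → headIs l as ∧ Q as) (seqs (suc n) s)
    ≡⟨ count-seqs-suc (λ as → headIs l as ∧ Q as) n s ⟩
  sumOneTo s (λ a → count (λ as → (a ≡ᵇ l) ∧ Q (a ∷ as)) (seqs n s))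
    ≡⟨ sumOneTo-single 1≤l l≤s (λ a a≢l → count-none (λ as → cong (_∧ Q (a ∷ as)) (dec-false (a ≟ l) a≢l)) (seqs n s)) ⟩
  count (λ as → (l ≡ᵇ l) ∧ Q (l ∷ as)) (seqs n s)
    ≡⟨ count-cong (λ as → cong (_∧ Q (l ∷ as)) (dec-true (l ≟ l) refl)) (seqs n s) ⟩
  count (Q ∘ (l ∷_)) (seqs n s)
    ∎

count-seqs-bounded : ∀ Q n → t ≤ s → (∀ as → T (Q as) → All (_≤ t) as) →
  count Q (seqs n s) ≡ count Q (seqs n t)
count-seqs-bounded Q zero _ _ = refl
count-seqs-bounded {t} {s} Q (suc n) t≤s bounded = begin
  count Q (seqs (suc n) s)                                 ≡⟨ count-seqs-suc Q n s ⟩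
  sumOneTo s (λ a → count (Q ∘ (a ∷_)) (seqs n s))
    ≡⟨ sumOneTo-cong {s} (λ a → count-seqs-bounded (Q ∘ (a ∷_)) n t≤s (tail-bounded a)) ⟩
  sumOneTo s (λ a → count (Q ∘ (a ∷_)) (seqs n t))
    ≡⟨ sumOneTo-vanishing t≤s (λ a t<a _ → count-none (head-too-big t<a) (seqs n t)) ⟩
  sumOneTo t (λ a → count (Q ∘ (a ∷_)) (seqs n t))        ≡⟨ count-seqs-suc Q n t ⟨
  count Q (seqs (suc n) t)                                 ∎
  where
  tail-bounded : ∀ a as → T (Q (a ∷ as)) → All (_≤ t) as
  tail-bounded a as Q[a∷as] with bounded (a ∷ as) Q[a∷as]
  ... | _ ∷ as≤t = as≤t

  head-too-big : ∀ {a} → t < a → ∀ as → Q (a ∷ as) ≡ false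
  head-too-big {a} t<a as with Q (a ∷ as) in Q[a∷as]≡true
  ... | false = refl
  ... | true with bounded (a ∷ as) (subst T (sym Q[a∷as]≡true) _)
  ...   | a≤t ∷ _ = ⊥-elim (<⇒≱ t<a a≤t)

findSpace-beyond : ∀ f xs {a} → m < a → findSpace f m xs a ≡ nothing
findSpace-beyond zero xs _ = refl
findSpace-beyond {m} (suc f) xs {a} m<a rewrite dec-false (a ≤? m) (<⇒≱ m<a) = refl

findSpace-beyond-full-last : ∀ f {xs a} → occupied xs (suc m) ≡ true → m < a →
  findSpace f (suc m) xs a ≡ nothing
findSpace-beyond-full-last zero _ _ = refl
findSpace-beyond-full-last {m} (suc f) {xs} last-full m<a with m≤n⇒m<n∨m≡n m<a
... | inj₁ 1+m<a = findSpace-beyond (suc f) xs 1+m<a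
... | inj₂ refl rewrite dec-true (suc m ≤? suc m) ≤-refl | last-full =
  findSpace-beyond f xs (n<1+n (suc m))

-- L is the occupancy of the lot 1..m+1 whose last space is full, R that of the lot 1..m.
record Padded (m : ℕ) (L R : List ℕ) : Set where
  field
    last-full : occupied L (suc m) ≡ true
    agree     : ∀ {x} → x ≤ m → occupied L x ≡ occupied R x
open Padded

padded-∷ : ∀ {L R} j → Padded m L R → Padded m (j ∷ L) (j ∷ R)
padded-∷ {m} j P .last-full rewrite last-full P = ∨-zeroʳ (j ≡ᵇ suc m)
padded-∷ j P .agree {x} x≤m = cong ((j ≡ᵇ x) ∨_) (agree P x≤m)

padded-last : ∀ m → Padded m (suc m ∷ []) []
padded-last m .last-full rewrite dec-true (suc m ≟ suc m) refl = refl
padded-last m .agree {x} x≤m rewrite dec-false (suc m ≟ x) (<⇒≢ (s≤s x≤m) ∘ sym) = refl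

-- m < a + f says that the fuel f suffices to scan the spaces a..m.
findSpace-padded : ∀ f {L R a} → Padded m L R → m < a + f →
  findSpace (suc f) (suc m) L a ≡ findSpace f m R a
findSpace-padded {m} f {L} {R} {a} P m<a+f with a ≤? m
... | no a≰m = begin
  findSpace (suc f) (suc m) L a   ≡⟨ findSpace-beyond-full-last (suc f) (last-full P) (≰⇒> a≰m) ⟩
  nothing                         ≡⟨ findSpace-beyond f R (≰⇒> a≰m) ⟨
  findSpace f m R a               ∎
findSpace-padded zero {a = a} P m<a+0 | yes a≤m =
  ⊥-elim (<⇒≱ (subst (_ <_) (+-identityʳ a) m<a+0) a≤m)
findSpace-padded {m} (suc f) {L} {R} {a} P m<a+1+f | yes a≤m
  rewrite dec-true (a ≤? suc m) (m≤n⇒m≤1+n a≤m) | dec-true (a ≤? m) a≤m | agree P a≤m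
  with occupied R a
... | true  = findSpace-padded f P (subst (m <_) (+-suc a f) m<a+1+f)
... | false = refl

parksAll-stuck : ∀ {occ a as} → findSpace m m occ a ≡ nothing → parksAll m occ (a ∷ as) ≡ false
parksAll-stuck {m} {occ} {a} stuck with findSpace m m occ a
... | nothing = refl

parksAll-padded : ∀ {L R} → Padded m L R → ∀ as →
  isPrefSet (suc m) as ∧ parksAll (suc m) L as ≡ isPrefSet m as ∧ parksAll m R as
parksAll-padded P [] = refl
parksAll-padded P (zero ∷ as) = refl
parksAll-padded {m} {L} {R} P (suc b ∷ as) with suc b ≤? m
... | yes 1+b≤m
  rewrite findSpace-padded m P (s≤s (m≤n+m m b))
        | dec-true (suc b ≤? suc m) (m≤n⇒m≤1+n 1+b≤m) | dec-true (suc b ≤? m) 1+b≤m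
  with findSpace m m R (suc b)
...   | nothing = trans (∧-zeroʳ _) (sym (∧-zeroʳ _))
...   | just j  = parksAll-padded (padded-∷ j P) as
parksAll-padded {m} {L} {R} P (suc b ∷ as) | no 1+b≰m
  rewrite dec-false (suc b ≤? m) 1+b≰m
  with m≤n⇒m<n∨m≡n (≰⇒> 1+b≰m)
... | inj₁ 1+m<1+b rewrite dec-false (suc b ≤? suc m) (<⇒≱ 1+m<1+b) = refl
... | inj₂ refl =
  trans (cong (_ ∧_) (parksAll-stuck {suc m} {L} {suc m} {as} (findSpace-beyond-full-last (suc m) (last-full P) (n<1+n m))))
        (∧-zeroʳ _)

isParkingFunction-∷-last : ∀ m as → isParkingFunction (suc m) (suc m ∷ as) ≡ isParkingFunction m as
isParkingFunction-∷-last m as rewrite dec-true (suc m ≤? suc m) ≤-refl =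
  parksAll-padded (padded-last m) as

isPrefSet⇒≤ : ∀ as → T (isPrefSet m as) → All (_≤ m) as
isPrefSet⇒≤ [] _ = []
isPrefSet⇒≤ {m} (a ∷ as) pref with to (T-∧ {(1 ≤ᵇ a) ∧ (a ≤ᵇ m)}) pref
... | range , pref-as with to (T-∧ {1 ≤ᵇ a}) range
...   | _ , a≤ᵇm = ≤ᵇ⇒≤ a m a≤ᵇm ∷ isPrefSet⇒≤ as pref-as

isParkingFunction⇒≤ : ∀ as → T (isParkingFunction m as) → All (_≤ m) as
isParkingFunction⇒≤ {m} as pf with to (T-∧ {isPrefSet m as}) pf
... | pref , _ = isPrefSet⇒≤ as pref

lemma4p1 : (k n : ℕ) → 1 Data.Nat.≤ n →
    pˡ≤ (n + k) n (n + k) (n + k) ≡ p≤ (n ∸ 1) (n + k ∸ 1) (n + k ∸ 1)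
lemma4p1 k (suc n) _ = begin
  pˡ≤ (suc last) (suc n) (suc last) (suc last)
    ≡⟨ count-headIs-seqs (isParkingFunction (suc last)) n (s≤s z≤n) ≤-refl ⟩
  count (isParkingFunction (suc last) ∘ (suc last ∷_)) (seqs n (suc last))
    ≡⟨ count-cong (isParkingFunction-∷-last last) (seqs n (suc last)) ⟩
  count (isParkingFunction last) (seqs n (suc last))
    ≡⟨ count-seqs-bounded (isParkingFunction last) n (n≤1+n last) isParkingFunction⇒≤ ⟩
  p≤ n last last
    ∎
  where
  last : ℕ
  last = n + k
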